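{- Let $r\geq 13$ be an integer and let $G$ be an $r$-minimal graph. If $v$ is a vertex of $G$ with $d_G(v)=3$, then $v$ is not contained in any triangle of $G$.
   Context: All graphs are finite, simple and undirected. A total $k$-coloring of a graph is a map from $V\cup E$ to $\{1,\dots,k\}$ assigning different colors to any two adjacent or incident elements. For an integer $r$, an $r$-minimal graph is a connected graph $G$ with maximum degree $\Delta(G)\leq r$ that has no total $(r+2)$-coloring, and that has the fewest edges among all connected graphs with maximum degree at most $r$ having no total $(r+2)$-coloring. -}

module Defs where

open import Data.Nat using (ℕ; zero; suc; _≤_; _<ᵇ_)
open import Data.Bool using (Bool; true; false; _∧_)
open import Data.Fin using (Fin; toℕ)
open import Data.List using (List; []; _∷_; map; concatMap; allFin)
open import Data.Product using (Σ; _×_; ∃; ∃-syntax)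
open import Relation.Binary.PropositionalEquality using (_≡_; _≢_)
open import Relation.Nullary using (¬_)

record Graph : Set where
  field
    n      : ℕ
    adj    : Fin n → Fin n → Bool
    sym    : ∀ u v → adj u v ≡ adj v u
    irrefl : ∀ v → adj v v ≡ false
open Graph public

Adj : (G : Graph) → Fin (n G) → Fin (n G) → Set
Adj G u v = adj G u v ≡ true

countTrue : List Bool → ℕ
countTrue []           = zero
countTrue (true ∷ bs)  = suc (countTrue bs)
countTrue (false ∷ bs) = countTrue bs

deg : (G : Graph) → Fin (n G) → ℕ
deg G v = countTrue (map (adj G v) (allFin (n G)))

MaxDegLE : Graph → ℕ → Set
MaxDegLE G r = ∀ v → deg G v ≤ r

numEdges : Graph → ℕ
numEdges G = countTrue (concatMap (λ u → map (λ w → (toℕ u <ᵇ toℕ w) ∧ adj G u w)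
                                              (allFin (n G)))
                                   (allFin (n G)))

data Walk (G : Graph) : Fin (n G) → Fin (n G) → Set where
  here : ∀ {u} → Walk G u u
  step : ∀ {u v w} → Adj G u v → Walk G v w → Walk G u w

Connected : Graph → Set
Connected G = ∀ u v → Walk G u v

-- A total k-colouring: a colour for every vertex and every edge
-- (edge uv gets colour ec u v = ec v u; values on non-edges are irrelevant)
-- such that adjacent or incident elements receive different colours.
record TotalColoring (G : Graph) (k : ℕ) : Set where
  field
    vc      : Fin (n G) → Fin k
    ec      : Fin (n G) → Fin (n G) → Fin k
    ec-sym  : ∀ u v → Adj G u v → ec u v ≡ ec v u
    vv-ok   : ∀ u v → Adj G u v → vc u ≢ vc v
    ve-ok   : ∀ u v → Adj G u v → ec u v ≢ vc u
    ee-ok   : ∀ u v w → Adj G u v → Adj G u w → v ≢ w → ec u v ≢ ec u w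

TotallyColorable : Graph → ℕ → Set
TotallyColorable G k = TotalColoring G k

Bad : ℕ → Graph → Set
Bad r G = Connected G × MaxDegLE G r × ¬ TotallyColorable G (suc (suc r))

Minimal : ℕ → Graph → Set
Minimal r G = Bad r G × (∀ (H : Graph) → Bad r H → numEdges G ≤ numEdges H)

InTriangle : (G : Graph) → Fin (n G) → Set
InTriangle G v = ∃[ u ] ∃[ w ] (Adj G v u × Adj G v w × Adj G u w)

-- Delete the side vu of the triangle vuw. The graph H = G − vu is still connected
-- (through w), has maximum degree at most r and fewer edges than G, so by minimality
-- it has a total (r+2)-colouring φ. Keep φ everywhere except on the three sides of
-- the triangle and on v. The side vu must avoid the at most r − 1 colours present
-- at u off the triangle and the colour of the third edge at v, likewise vw at w,
-- and uw must avoid the colours present at u and at w; the old colour of uw always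
-- qualifies for uw, and a short case analysis shows that three distinct admissible
-- colours exist. Finally v, of degree 3, sees at most six colours and 6 < r + 2.
-- So G would have a total (r+2)-colouring after all.
module Submission where

open import Defs hiding (sym)
open import Data.Bool using (Bool; true; false; _∧_; not)
open import Data.Bool.Properties using (T-≡; ∧-zeroʳ) renaming (_≟_ to _≟ᵇ_)
open import Data.Empty using (⊥-elim)
open import Data.Fin using (Fin; toℕ; _≟_)
open import Data.Fin.Properties using (injective⇒≤; all?; ¬∀⟶∃¬; <-cmp)
open import Data.List using (List; []; _∷_; _++_; map; concatMap; filter; length; lookup; allFin)
open import Data.List.Properties using (length-map; length-++; filter-notAll; filter-reject)
open import Data.List.Membership.Propositional using (_∈_; _∉_)
open import Data.List.Relation.Binary.Subset.Propositional using (_⊆_)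
open import Data.List.Relation.Binary.Subset.Propositional.Properties using (∷⁺ʳ)
open import Data.List.Membership.Propositional.Properties
  using (∈-allFin; ∈-filter⁺; ∈-filter⁻; ∈-map⁺; ∈-map⁻; ∈-++⁺ˡ; ∈-++⁺ʳ)
open import Data.List.Relation.Unary.Any as Any using (here; there)
open import Data.List.Relation.Unary.Any.Properties using (lookup-index; singleton⁻)
open import Data.Nat using (ℕ; suc; s≤s⁻¹; _+_; _≤_; _<_; _<ᵇ_; z≤n; s≤s)
open import Data.Nat.Properties
  using (≤-trans; ≤-reflexive; m≤n⇒m≤1+n; m<n⇒m<1+n; +-mono-≤; +-monoˡ-≤; +-mono-<-≤; +-mono-≤-<; <⇒<ᵇ; <⇒≱)
open import Data.Product using (_×_; _,_; ∃; proj₁; proj₂)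
open import Data.Sum using (_⊎_; inj₁; inj₂)
open import Function using (_∘_; Equivalence; mk⇔)
open import Relation.Binary.PropositionalEquality using (_≡_; _≢_; refl; sym; trans; cong; cong₂; subst)
open import Relation.Binary using (tri<; tri≈; tri>)
open import Relation.Nullary using (¬_; Dec; yes; no; does)
open import Relation.Nullary.Decidable using (_×-dec_; _⊎-dec_; dec-true; dec-false; does-⇔)
open import Relation.Unary using (Decidable)

countTrue-++ : ∀ bs cs → countTrue (bs ++ cs) ≡ countTrue bs + countTrue cs
countTrue-++ []           cs = refl
countTrue-++ (true ∷ bs)  cs = cong suc (countTrue-++ bs cs)
countTrue-++ (false ∷ bs) cs = countTrue-++ bs cs

countTrue-∷-mono : ∀ {b c bs cs} → (b ≡ true → c ≡ true) →
  countTrue bs ≤ countTrue cs → countTrue (b ∷ bs) ≤ countTrue (c ∷ cs)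
countTrue-∷-mono {false} {false} _ le = le
countTrue-∷-mono {false} {true}  _ le = m≤n⇒m≤1+n le
countTrue-∷-mono {true}  {true}  _ le = s≤s le
countTrue-∷-mono {true}  {false} b⇒c _ with () ← b⇒c refl

countTrue-∷-< : ∀ {b c bs cs} → (b ≡ true → c ≡ true) →
  countTrue bs < countTrue cs → countTrue (b ∷ bs) < countTrue (c ∷ cs)
countTrue-∷-< {false} {false} _ lt = lt
countTrue-∷-< {false} {true}  _ lt = m<n⇒m<1+n lt
countTrue-∷-< {true}  {true}  _ lt = s≤s lt
countTrue-∷-< {true}  {false} b⇒c _ with () ← b⇒c refl

∧-monoʳ-true : ∀ {x y z} → (y ≡ true → z ≡ true) → x ∧ y ≡ true → x ∧ z ≡ true
∧-monoʳ-true {true} y⇒z x∧y = y⇒z x∧y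

module _ {A : Set} {f g : A → Bool} (f⇒g : ∀ x → f x ≡ true → g x ≡ true) where

  countTrue-map-mono : ∀ xs → countTrue (map f xs) ≤ countTrue (map g xs)
  countTrue-map-mono []       = z≤n
  countTrue-map-mono (x ∷ xs) = countTrue-∷-mono (f⇒g x) (countTrue-map-mono xs)

  countTrue-map-< : ∀ {a} xs → a ∈ xs → f a ≡ false → g a ≡ true →
    countTrue (map f xs) < countTrue (map g xs)
  countTrue-map-< (x ∷ xs) (here refl) fa ga rewrite fa | ga = s≤s (countTrue-map-mono xs)
  countTrue-map-< (x ∷ xs) (there a∈) fa ga = countTrue-∷-< (f⇒g x) (countTrue-map-< xs a∈ fa ga)

module _ {A B : Set} {f g : A → B → Bool} (f⇒g : ∀ x y → f x y ≡ true → g x y ≡ true)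
         (ys : List B) where

  countTrue-concatMap-mono : ∀ xs →
    countTrue (concatMap (λ x → map (f x) ys) xs) ≤ countTrue (concatMap (λ x → map (g x) ys) xs)
  countTrue-concatMap-mono []       = z≤n
  countTrue-concatMap-mono (x ∷ xs)
    rewrite countTrue-++ (map (f x) ys) (concatMap (λ x → map (f x) ys) xs)
          | countTrue-++ (map (g x) ys) (concatMap (λ x → map (g x) ys) xs)
    = +-mono-≤ (countTrue-map-mono (f⇒g x) ys) (countTrue-concatMap-mono xs)

  countTrue-concatMap-< : ∀ {a b} xs → a ∈ xs → b ∈ ys → f a b ≡ false → g a b ≡ true →
    countTrue (concatMap (λ x → map (f x) ys) xs) < countTrue (concatMap (λ x → map (g x) ys) xs)
  countTrue-concatMap-< (x ∷ xs) a∈ b∈ fab gab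
    rewrite countTrue-++ (map (f x) ys) (concatMap (λ x → map (f x) ys) xs)
          | countTrue-++ (map (g x) ys) (concatMap (λ x → map (g x) ys) xs)
    with a∈
  ... | here refl = +-mono-<-≤ (countTrue-map-< (f⇒g x) ys b∈ fab gab) (countTrue-concatMap-mono xs)
  ... | there a∈′ = +-mono-≤-< (countTrue-map-mono (f⇒g x) ys) (countTrue-concatMap-< xs a∈′ b∈ fab gab)

length-filter≡countTrue : ∀ {A : Set} (f : A → Bool) xs →
  length (filter (λ x → f x ≟ᵇ true) xs) ≡ countTrue (map f xs)
length-filter≡countTrue f []       = refl
length-filter≡countTrue f (x ∷ xs) with f x
... | true  = cong suc (length-filter≡countTrue f xs)
... | false = length-filter≡countTrue f xs

module _ {A : Set} {P : A → Set} (P? : Decidable P) where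

  filter-rejects-two : ∀ {x y} xs → x ≢ y → x ∈ xs → y ∈ xs → ¬ P x → ¬ P y →
    2 + length (filter P? xs) ≤ length xs
  filter-rejects-two (z ∷ xs) x≢y (here refl) (here refl) _ _ = ⊥-elim (x≢y refl)
  filter-rejects-two (z ∷ xs) x≢y (here refl) (there y∈) ¬Px ¬Py
    rewrite filter-reject P? {xs = xs} ¬Px = s≤s (filter-notAll P? xs (Any.map (λ { refl → ¬Py }) y∈))
  filter-rejects-two (z ∷ xs) x≢y (there x∈) (here refl) ¬Px ¬Py
    rewrite filter-reject P? {xs = xs} ¬Py = s≤s (filter-notAll P? xs (Any.map (λ { refl → ¬Px }) x∈))
  filter-rejects-two (z ∷ xs) x≢y (there x∈) (there y∈) ¬Px ¬Py with P? z
  ... | yes _ = s≤s (filter-rejects-two xs x≢y x∈ y∈ ¬Px ¬Py)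
  ... | no  _ = m≤n⇒m≤1+n (filter-rejects-two xs x≢y x∈ y∈ ¬Px ¬Py)

module _ {k : ℕ} where

  Covers : List (Fin k) → Set
  Covers L = ∀ c → c ∈ L

  open import Data.List.Membership.DecPropositional (_≟_ {k}) using (_∈?_)

  covers? : ∀ L → Dec (Covers L)
  covers? L = all? (_∈? L)

  covers⇒≤ : ∀ {L} → Covers L → k ≤ length L
  covers⇒≤ {L} cov = injective⇒≤ λ {c} {d} same-index →
    trans (lookup-index (cov c)) (trans (cong (lookup L) same-index) (sym (lookup-index (cov d))))

  short⇒¬Covers : ∀ L → length L < k → ¬ Covers L
  short⇒¬Covers L short cov = <⇒≱ short (covers⇒≤ cov)

  ¬Covers⇒∃∉ : ∀ {L} → ¬ Covers L → ∃ (_∉ L)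
  ¬Covers⇒∃∉ {L} = ¬∀⟶∃¬ k (_∈ L) (_∈? L)

  Covers-⊆ : ∀ {L M} → Covers L → L ⊆ M → Covers M
  Covers-⊆ cov L⊆M c = L⊆M (cov c)

  ∈⇒∷⊆ : ∀ {x : Fin k} {L} → x ∈ L → x ∷ L ⊆ L
  ∈⇒∷⊆ x∈L (here refl) = x∈L
  ∈⇒∷⊆ _   (there y∈L) = y∈L

  -- α, β, γ are meant for the sides vu, vw, uw of a triangle: Fu and Fw list the colours
  -- present at u and at w off the triangle, e is the colour of the third edge at v, and
  -- c (below) is the old colour of uw.
  record TriangleColours (Fu Fw : List (Fin k)) (e : Fin k) : Set where
    field
      α β γ : Fin k
      α∉Fu  : α ∉ Fu
      β∉Fw  : β ∉ Fw
      γ∉Fu  : γ ∉ Fu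
      γ∉Fw  : γ ∉ Fw
      α≢e   : α ≢ e
      β≢e   : β ≢ e
      α≢β   : α ≢ β
      α≢γ   : α ≢ γ
      β≢γ   : β ≢ γ

  triangleColours : ∀ {Fu Fw c} e → 3 + length Fu ≤ k → 3 + length Fw ≤ k →
    c ∉ Fu → c ∉ Fw → TriangleColours Fu Fw e
  triangleColours {Fu} {Fw} {c} e shortU shortW c∉Fu c∉Fw
    with α₀ , α₀∉ ← ¬Covers⇒∃∉ (short⇒¬Covers (c ∷ e ∷ Fu) shortU)
       | covers? (α₀ ∷ c ∷ e ∷ Fw)
  ... | no ¬covW with β , β∉ ← ¬Covers⇒∃∉ ¬covW = record
    { α = α₀ ; β = β ; γ = c
    ; α∉Fu = α₀∉ ∘ there ∘ there ; β∉Fw = β∉ ∘ there ∘ there ∘ there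
    ; γ∉Fu = c∉Fu ; γ∉Fw = c∉Fw
    ; α≢e = α₀∉ ∘ there ∘ here ; β≢e = β∉ ∘ there ∘ there ∘ here
    ; α≢β = λ α₀≡β → β∉ (here (sym α₀≡β)) ; α≢γ = α₀∉ ∘ here ; β≢γ = β∉ ∘ there ∘ here }
  ... | yes covW with covers? (α₀ ∷ c ∷ e ∷ Fu)
  ...   | no ¬covU with α , α∉ ← ¬Covers⇒∃∉ ¬covU = record
    { α = α ; β = α₀ ; γ = c
    ; α∉Fu = α∉ ∘ there ∘ there ∘ there
    ; β∉Fw = λ α₀∈Fw → short⇒¬Covers (c ∷ e ∷ Fw) shortW
                           (Covers-⊆ covW (∈⇒∷⊆ (there (there α₀∈Fw))))
    ; γ∉Fu = c∉Fu ; γ∉Fw = c∉Fw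
    ; α≢e = α∉ ∘ there ∘ there ∘ here ; β≢e = α₀∉ ∘ there ∘ here
    ; α≢β = α∉ ∘ here ; α≢γ = α∉ ∘ there ∘ here ; β≢γ = α₀∉ ∘ here }
  -- Both lists now cover all k colours with k entries, so neither repeats a colour.
  ...   | yes covU = record
    { α = α₀ ; β = c ; γ = e
    ; α∉Fu = α₀∉ ∘ there ∘ there ; β∉Fw = c∉Fw
    ; γ∉Fu = λ e∈Fu → short⇒¬Covers (α₀ ∷ c ∷ Fu) shortU
                         (Covers-⊆ covU (∷⁺ʳ α₀ (∷⁺ʳ c (∈⇒∷⊆ e∈Fu))))
    ; γ∉Fw = λ e∈Fw → short⇒¬Covers (α₀ ∷ c ∷ Fw) shortW
                         (Covers-⊆ covW (∷⁺ʳ α₀ (∷⁺ʳ c (∈⇒∷⊆ e∈Fw))))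
    ; α≢e = α₀∉ ∘ there ∘ here ; β≢e = c≢e
    ; α≢β = α₀∉ ∘ here ; α≢γ = α₀∉ ∘ there ∘ here ; β≢γ = c≢e }
    where
      c≢e : c ≢ e
      c≢e c≡e = short⇒¬Covers (α₀ ∷ e ∷ Fw) shortW (Covers-⊆ covW (∷⁺ʳ α₀ (∈⇒∷⊆ (here c≡e))))

⊆-singleton : ∀ {A : Set} (d : A) xs → length xs ≤ 1 → ∃ λ e → xs ⊆ e ∷ []
⊆-singleton d []          _        = d , λ ()
⊆-singleton d (x ∷ [])    _        = x , λ x∈ → x∈
⊆-singleton d (x ∷ _ ∷ _) (s≤s ())

SamePair : {A : Set} → A → A → A → A → Set
SamePair p q a b = (p ≡ a × q ≡ b) ⊎ (p ≡ b × q ≡ a)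

module _ {A : Set} {p q a b : A} where

  SamePair-swap : SamePair p q a b → SamePair q p a b
  SamePair-swap (inj₁ (p≡a , q≡b)) = inj₂ (q≡b , p≡a)
  SamePair-swap (inj₂ (p≡b , q≡a)) = inj₁ (q≡a , p≡b)

  SamePair-flip : SamePair p q a b → SamePair p q b a
  SamePair-flip (inj₁ pq≡ab) = inj₂ pq≡ab
  SamePair-flip (inj₂ pq≡ba) = inj₁ pq≡ba

  SamePair-functional : ∀ {s} → a ≢ b → SamePair p q a b → SamePair p s a b → q ≡ s
  SamePair-functional _   (inj₁ (_   , q≡b)) (inj₁ (_   , s≡b)) = trans q≡b (sym s≡b)
  SamePair-functional a≢b (inj₁ (p≡a , _))   (inj₂ (p≡b , _))   = ⊥-elim (a≢b (trans (sym p≡a) p≡b))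
  SamePair-functional a≢b (inj₂ (p≡b , _))   (inj₁ (p≡a , _))   = ⊥-elim (a≢b (trans (sym p≡a) p≡b))
  SamePair-functional _   (inj₂ (_   , q≡a)) (inj₂ (_   , s≡a)) = trans q≡a (sym s≡a)

  SamePair-cancelˡ : ∀ {c} → p ≢ q → SamePair p q a b → SamePair p q a c → b ≡ c
  SamePair-cancelˡ _   (inj₁ (_   , q≡b)) (inj₁ (_   , q≡c)) = trans (sym q≡b) q≡c
  SamePair-cancelˡ p≢q (inj₁ (p≡a , _))   (inj₂ (_   , q≡a)) = ⊥-elim (p≢q (trans p≡a (sym q≡a)))
  SamePair-cancelˡ p≢q (inj₂ (_   , q≡a)) (inj₁ (p≡a , _))   = ⊥-elim (p≢q (trans p≡a (sym q≡a)))
  SamePair-cancelˡ _   (inj₂ (p≡b , _))   (inj₂ (p≡c , _))   = trans (sym p≡b) p≡c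

samePair? : ∀ {m} (p q a b : Fin m) → Dec (SamePair p q a b)
samePair? p q a b = (p ≟ a ×-dec q ≟ b) ⊎-dec (p ≟ b ×-dec q ≟ a)

samePair?-swap : ∀ {m} (p q a b : Fin m) → does (samePair? p q a b) ≡ does (samePair? q p a b)
samePair?-swap p q a b = does-⇔ (mk⇔ SamePair-swap SamePair-swap) (samePair? p q a b) (samePair? q p a b)

module _ (G : Graph) where

  Adj-sym : ∀ {p q} → Adj G p q → Adj G q p
  Adj-sym {p} {q} p~q = trans (Graph.sym G q p) p~q

  Adj⇒≢ : ∀ {p q} → Adj G p q → p ≢ q
  Adj⇒≢ {p} p~p refl with () ← trans (sym p~p) (irrefl G p)

  neighbours : Fin (n G) → List (Fin (n G))
  neighbours p = filter (λ q → adj G p q ≟ᵇ true) (allFin (n G))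

  ∈-neighbours : ∀ {p q} → Adj G p q → q ∈ neighbours p
  ∈-neighbours {p} {q} p~q = ∈-filter⁺ (λ q → adj G p q ≟ᵇ true) (∈-allFin q) p~q

  ∈-neighbours⁻ : ∀ {p q} → q ∈ neighbours p → Adj G p q
  ∈-neighbours⁻ {p} q∈ = proj₂ (∈-filter⁻ (λ q → adj G p q ≟ᵇ true) {xs = allFin (n G)} q∈)

  length-neighbours : ∀ p → length (neighbours p) ≡ deg G p
  length-neighbours p = length-filter≡countTrue (adj G p) (allFin (n G))

module _ {G : Graph} where

  _◅◅_ : ∀ {p q s} → Walk G p q → Walk G q s → Walk G p s
  here       ◅◅ q⇝s = q⇝s
  step e p⇝q ◅◅ q⇝s = step e (p⇝q ◅◅ q⇝s)

  reverse : ∀ {p q} → Walk G p q → Walk G q p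
  reverse here        = here
  reverse (step e ws) = reverse ws ◅◅ step (Adj-sym G e) here

deleteEdge : (G : Graph) → Fin (n G) → Fin (n G) → Graph
deleteEdge G a b = record
  { n      = n G
  ; adj    = λ p q → adj G p q ∧ not (does (samePair? p q a b))
  ; sym    = λ p q → cong₂ (λ x y → x ∧ not y) (Graph.sym G p q) (samePair?-swap p q a b)
  ; irrefl = λ p → cong (_∧ not (does (samePair? p p a b))) (irrefl G p)
  }

module _ (G : Graph) {a b : Fin (n G)} where

  private
    H = deleteEdge G a b

  deleteEdge-Adj⁻ : ∀ {p q} → Adj H p q → Adj G p q
  deleteEdge-Adj⁻ {p} {q} _ with adj G p q
  deleteEdge-Adj⁻ _  | true = refl

  deleteEdge-Adj⁺ : ∀ {p q} → Adj G p q → ¬ SamePair p q a b → Adj H p q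
  deleteEdge-Adj⁺ {p} {q} p~q pq≢ab rewrite p~q | dec-false (samePair? p q a b) pq≢ab = refl

  deleteEdge-maxDeg : ∀ {r} → MaxDegLE G r → MaxDegLE H r
  deleteEdge-maxDeg Δ≤r p = ≤-trans (countTrue-map-mono (λ _ → deleteEdge-Adj⁻) (allFin (n G))) (Δ≤r p)

  deleteEdge-connected : Connected G → Walk H a b → Connected H
  deleteEdge-connected conn a⇝b p q = keep (conn p q)
    where
      keep : ∀ {p q} → Walk G p q → Walk H p q
      keep here = here
      keep (step {x} {y} x~y ws) with samePair? x y a b
      ... | yes (inj₁ (refl , refl)) = a⇝b ◅◅ keep ws
      ... | yes (inj₂ (refl , refl)) = reverse a⇝b ◅◅ keep ws
      ... | no  xy≢ab                = step (deleteEdge-Adj⁺ x~y xy≢ab) (keep ws)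

  private
    numEdges-drop : ∀ {x y} → SamePair x y a b → Adj G x y → toℕ x < toℕ y → numEdges H < numEdges G
    numEdges-drop {x} {y} xy≡ab x~y x<y =
      countTrue-concatMap-< (λ _ _ → ∧-monoʳ-true deleteEdge-Adj⁻) (allFin (n G)) (allFin (n G))
                            (∈-allFin x) (∈-allFin y) dropped kept
      where
        dropped : (toℕ x <ᵇ toℕ y) ∧ adj H x y ≡ false
        dropped rewrite dec-true (samePair? x y a b) xy≡ab | ∧-zeroʳ (adj G x y) = ∧-zeroʳ _
        kept : (toℕ x <ᵇ toℕ y) ∧ adj G x y ≡ true
        kept rewrite Equivalence.to T-≡ (<⇒<ᵇ x<y) | x~y = refl

  deleteEdge-numEdges : Adj G a b → numEdges H < numEdges G
  deleteEdge-numEdges a~b with <-cmp a b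
  ... | tri< a<b _ _ = numEdges-drop (inj₁ (refl , refl)) a~b a<b
  ... | tri≈ _ a≡b _ = ⊥-elim (Adj⇒≢ G a~b a≡b)
  ... | tri> _ _ b<a = numEdges-drop (inj₂ (refl , refl)) (Adj-sym G a~b) b<a

data Side : Set where
  vu vw uw : Side

module Triangle (G : Graph) {v u w : Fin (n G)}
                (v~u : Adj G v u) (v~w : Adj G v w) (u~w : Adj G u w) where

  H : Graph
  H = deleteEdge G v u

  end₀ end₁ : Side → Fin (n G)
  end₀ vu = v
  end₀ vw = v
  end₀ uw = u
  end₁ vu = u
  end₁ vw = w
  end₁ uw = w

  end-Adj : ∀ σ → Adj G (end₀ σ) (end₁ σ)
  end-Adj vu = v~u
  end-Adj vw = v~w
  end-Adj uw = u~w

  OnSide : Side → Fin (n G) → Fin (n G) → Set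
  OnSide σ p q = SamePair p q (end₀ σ) (end₁ σ)

  NotSide : Fin (n G) → Fin (n G) → Set
  NotSide p q = ∀ σ → ¬ OnSide σ p q

  OnSide⇒Adj : ∀ σ {p q} → OnSide σ p q → Adj G p q
  OnSide⇒Adj σ (inj₁ (refl , refl)) = end-Adj σ
  OnSide⇒Adj σ (inj₂ (refl , refl)) = Adj-sym G (end-Adj σ)

  OnSide⇒≢ : ∀ σ {p q} → OnSide σ p q → p ≢ q
  OnSide⇒≢ σ s = Adj⇒≢ G (OnSide⇒Adj σ s)

  onSide-unique : ∀ {σ σ′ p q} → OnSide σ p q → OnSide σ′ p q → σ ≡ σ′
  onSide-unique {vu} {vu} _ _ = refl
  onSide-unique {vw} {vw} _ _ = refl
  onSide-unique {uw} {uw} _ _ = refl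
  onSide-unique {vu} {vw} s s′ = ⊥-elim (Adj⇒≢ G u~w (SamePair-cancelˡ (OnSide⇒≢ vu s) s s′))
  onSide-unique {vw} {vu} s s′ = ⊥-elim (Adj⇒≢ G u~w (SamePair-cancelˡ (OnSide⇒≢ vw s) s′ s))
  onSide-unique {vu} {uw} s s′ =
    ⊥-elim (Adj⇒≢ G v~w (SamePair-cancelˡ (OnSide⇒≢ vu s) (SamePair-flip s) s′))
  onSide-unique {uw} {vu} s s′ =
    ⊥-elim (Adj⇒≢ G v~w (SamePair-cancelˡ (OnSide⇒≢ uw s) (SamePair-flip s′) s))
  onSide-unique {vw} {uw} s s′ =
    ⊥-elim (Adj⇒≢ G v~u (SamePair-cancelˡ (OnSide⇒≢ vw s) (SamePair-flip s) (SamePair-flip s′)))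
  onSide-unique {uw} {vw} s s′ =
    ⊥-elim (Adj⇒≢ G v~u (SamePair-cancelˡ (OnSide⇒≢ uw s) (SamePair-flip s′) (SamePair-flip s)))

  data Kind (p q : Fin (n G)) : Set where
    new : ∀ σ → OnSide σ p q → Kind p q
    old : NotSide p q → Kind p q

  kind : ∀ p q → Kind p q
  kind p q with samePair? p q v u | samePair? p q v w | samePair? p q u w
  ... | yes s | _     | _     = new vu s
  ... | no _  | yes s | _     = new vw s
  ... | no _  | no _  | yes s = new uw s
  ... | no ¬s₁ | no ¬s₂ | no ¬s₃ = old λ { vu → ¬s₁ ; vw → ¬s₂ ; uw → ¬s₃ }

  notSide? : ∀ p q → Dec (NotSide p q)
  notSide? p q with kind p q
  ... | new σ s = no λ ns → ns σ s
  ... | old ns  = yes ns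

  NotSide⇒Adj-H : ∀ {p q} → Adj G p q → NotSide p q → Adj H p q
  NotSide⇒Adj-H p~q ns = deleteEdge-Adj⁺ G p~q (ns vu)

  OnSide⇒Adj-H : ∀ σ {p q} → σ ≢ vu → OnSide σ p q → Adj H p q
  OnSide⇒Adj-H σ σ≢vu s = deleteEdge-Adj⁺ G (OnSide⇒Adj σ s) (σ≢vu ∘ onSide-unique s)

  ≢v⇒Adj-H : ∀ {p q} → p ≢ v → q ≢ v → Adj G p q → Adj H p q
  ≢v⇒Adj-H p≢v q≢v p~q =
    deleteEdge-Adj⁺ G p~q λ { (inj₁ (p≡v , _)) → p≢v p≡v ; (inj₂ (_ , q≡v)) → q≢v q≡v }

  v⇝u : Walk H v u
  v⇝u = step (OnSide⇒Adj-H vw (λ ()) (inj₁ (refl , refl)))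
             (step (OnSide⇒Adj-H uw (λ ()) (inj₂ (refl , refl))) here)

  offSideNeighbours : Fin (n G) → List (Fin (n G))
  offSideNeighbours p = filter (notSide? p) (neighbours G p)

  length-offSideNeighbours : ∀ σ σ′ {p x y} → OnSide σ p x → OnSide σ′ p y → x ≢ y →
    2 + length (offSideNeighbours p) ≤ deg G p
  length-offSideNeighbours σ σ′ {p} s s′ x≢y =
    ≤-trans (filter-rejects-two (notSide? p) (neighbours G p) x≢y
                                (∈-neighbours G (OnSide⇒Adj σ s)) (∈-neighbours G (OnSide⇒Adj σ′ s′))
                                (λ ns → ns _ s) (λ ns → ns _ s′))
            (≤-reflexive (length-neighbours G p))

  ∈-offSideNeighbours⁻ : ∀ {p x} → x ∈ offSideNeighbours p → Adj G p x × NotSide p x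
  ∈-offSideNeighbours⁻ {p} x∈ with x∈N , ns ← ∈-filter⁻ (notSide? p) x∈ = ∈-neighbours⁻ G x∈N , ns

  module Recolour {k : ℕ} (φ : TotalColoring H k) where

    open TotalColoring φ public using () renaming
      (vc to vc₀; ec to ec₀; ec-sym to ec₀-sym; vv-ok to vv₀-ok; ve-ok to ve₀-ok; ee-ok to ee₀-ok)

    FreshAt : Fin (n G) → Fin k → Set
    FreshAt p c = ∀ s → Adj G p s → NotSide p s → c ≢ ec₀ p s

    ∉⇒FreshAt : ∀ {p c} → c ∉ map (ec₀ p) (offSideNeighbours p) → FreshAt p c
    ∉⇒FreshAt {p} c∉ s p~s ns c≡ =
      c∉ (Any.map (trans c≡) (∈-map⁺ (ec₀ p) (∈-filter⁺ (notSide? p) (∈-neighbours G p~s) ns)))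

    oldColour-fresh : ∀ σ {p t} → σ ≢ vu → OnSide σ p t →
      ec₀ p t ∉ vc₀ p ∷ map (ec₀ p) (offSideNeighbours p)
    oldColour-fresh σ σ≢vu s (here eq) = ve₀-ok _ _ (OnSide⇒Adj-H σ σ≢vu s) eq
    oldColour-fresh σ {p} {t} σ≢vu s (there m)
      with x , x∈ , eq ← ∈-map⁻ (ec₀ p) m
      with p~x , ns ← ∈-offSideNeighbours⁻ x∈
      = ee₀-ok p t x (OnSide⇒Adj-H σ σ≢vu s) (NotSide⇒Adj-H p~x ns) (λ { refl → ns σ s }) eq

    -- κ σ is the new colour of the side σ and δ that of v; everything else keeps its φ-colour.
    record Recolouring : Set where
      field
        κ           : Side → Fin k
        δ           : Fin k
        κ-injective : ∀ {σ σ′} → σ ≢ σ′ → κ σ ≢ κ σ′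
        κ-fresh     : ∀ {σ p q} → OnSide σ p q → FreshAt p (κ σ)
        κ-vertex    : ∀ {σ p q} → OnSide σ p q → p ≢ v → κ σ ≢ vc₀ p
        δ-side      : ∀ {σ q} → OnSide σ v q → δ ≢ κ σ
        δ-fresh     : FreshAt v δ
        δ-neighbour : ∀ {q} → Adj G v q → δ ≢ vc₀ q

    recolour : Recolouring → TotalColoring G k
    recolour R = record
      { vc     = λ p → vertexColour (p ≟ v)
      ; ec     = λ p q → edgeColour (kind p q)
      ; ec-sym = λ p q p~q → edgeColour-sym p~q (kind p q) (kind q p)
      ; vv-ok  = λ p q p~q → vertexColours-differ p~q (p ≟ v) (q ≟ v)
      ; ve-ok  = λ p q p~q → edge-vertex-differ p~q (kind p q) (p ≟ v)
      ; ee-ok  = λ p q s p~q p~s q≢s → edgeColours-differ p~q p~s q≢s (kind p q) (kind p s)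
      }
      where
        open Recolouring R

        edgeColour : ∀ {p q} → Kind p q → Fin k
        edgeColour (new σ _)       = κ σ
        edgeColour {p} {q} (old _) = ec₀ p q

        vertexColour : ∀ {p} → Dec (p ≡ v) → Fin k
        vertexColour (yes _)     = δ
        vertexColour {p} (no _)  = vc₀ p

        edgeColour-sym : ∀ {p q} → Adj G p q → (K : Kind p q) (K′ : Kind q p) →
          edgeColour K ≡ edgeColour K′
        edgeColour-sym _   (new σ s) (new σ′ s′) = cong κ (onSide-unique s (SamePair-swap s′))
        edgeColour-sym _   (new σ s) (old ns′)   = ⊥-elim (ns′ σ (SamePair-swap s))
        edgeColour-sym _   (old ns)  (new σ′ s′) = ⊥-elim (ns σ′ (SamePair-swap s′))
        edgeColour-sym p~q (old ns)  (old _)     = ec₀-sym _ _ (NotSide⇒Adj-H p~q ns)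

        vertexColours-differ : ∀ {p q} → Adj G p q → (d : Dec (p ≡ v)) (d′ : Dec (q ≡ v)) →
          vertexColour d ≢ vertexColour d′
        vertexColours-differ p~q (yes refl) (yes refl) = ⊥-elim (Adj⇒≢ G p~q refl)
        vertexColours-differ p~q (yes refl) (no _)     = δ-neighbour p~q
        vertexColours-differ p~q (no _)     (yes refl) = δ-neighbour (Adj-sym G p~q) ∘ sym
        vertexColours-differ p~q (no p≢v)   (no q≢v)   = vv₀-ok _ _ (≢v⇒Adj-H p≢v q≢v p~q)

        edge-vertex-differ : ∀ {p q} → Adj G p q → (K : Kind p q) (d : Dec (p ≡ v)) →
          edgeColour K ≢ vertexColour d
        edge-vertex-differ _   (new σ s) (yes refl) = δ-side s ∘ sym
        edge-vertex-differ _   (new σ s) (no p≢v)   = κ-vertex s p≢v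
        edge-vertex-differ p~q (old ns)  (yes refl) = δ-fresh _ p~q ns ∘ sym
        edge-vertex-differ p~q (old ns)  (no _)     = ve₀-ok _ _ (NotSide⇒Adj-H p~q ns)

        edgeColours-differ : ∀ {p q s} → Adj G p q → Adj G p s → q ≢ s →
          (K : Kind p q) (K′ : Kind p s) → edgeColour K ≢ edgeColour K′
        edgeColours-differ _ _ q≢s (new σ t) (new σ′ t′) =
          κ-injective λ { refl → q≢s (SamePair-functional (Adj⇒≢ G (end-Adj σ)) t t′) }
        edgeColours-differ _ p~s _ (new σ t) (old ns′)   = κ-fresh t _ p~s ns′
        edgeColours-differ p~q _ _ (old ns) (new σ′ t′)  = κ-fresh t′ _ p~q ns ∘ sym
        edgeColours-differ p~q p~s q≢s (old ns) (old ns′) =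
          ee₀-ok _ _ _ (NotSide⇒Adj-H p~q ns) (NotSide⇒Adj-H p~s ns′) q≢s

  module Extension {r : ℕ} (Δ≤r : MaxDegLE G r) (5≤r : 5 ≤ r) (deg≡3 : deg G v ≡ 3)
                 (φ : TotalColoring H (2 + r)) where

    open Recolour φ

    forbiddenAt : Fin (n G) → List (Fin (2 + r))
    forbiddenAt p = vc₀ p ∷ map (ec₀ p) (offSideNeighbours p)

    forbiddenAt-short : ∀ σ σ′ {p x y} → OnSide σ p x → OnSide σ′ p y → x ≢ y →
      3 + length (forbiddenAt p) ≤ 2 + r
    forbiddenAt-short σ σ′ {p} s s′ x≢y rewrite length-map (ec₀ p) (offSideNeighbours p) =
      s≤s (s≤s (≤-trans (length-offSideNeighbours σ σ′ s s′ x≢y) (Δ≤r p)))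

    offSide-v-≤1 : length (offSideNeighbours v) ≤ 1
    offSide-v-≤1 = s≤s⁻¹ (s≤s⁻¹ (≤-trans
      (length-offSideNeighbours vu vw (inj₁ (refl , refl)) (inj₁ (refl , refl)) (Adj⇒≢ G u~w))
      (≤-reflexive deg≡3)))

    -- The default ec₀ u w is never used: v has exactly one neighbour off the triangle.
    thirdColour : ∃ λ e → map (ec₀ v) (offSideNeighbours v) ⊆ e ∷ []
    thirdColour = ⊆-singleton (ec₀ u w) (map (ec₀ v) (offSideNeighbours v))
                              (≤-trans (≤-reflexive (length-map (ec₀ v) (offSideNeighbours v))) offSide-v-≤1)

    e : Fin (2 + r)
    e = proj₁ thirdColour

    freshAtV : ∀ {c} → c ≢ e → FreshAt v c
    freshAtV c≢e = ∉⇒FreshAt (c≢e ∘ singleton⁻ ∘ proj₂ thirdColour)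

    u~wᴴ : Adj H u w
    u~wᴴ = OnSide⇒Adj-H uw (λ ()) (inj₁ (refl , refl))

    colours : TriangleColours (forbiddenAt u) (forbiddenAt w) e
    colours = triangleColours e
      (forbiddenAt-short vu uw (inj₂ (refl , refl)) (inj₁ (refl , refl)) (Adj⇒≢ G v~w))
      (forbiddenAt-short vw uw (inj₂ (refl , refl)) (inj₂ (refl , refl)) (Adj⇒≢ G v~u))
      (oldColour-fresh uw (λ ()) (inj₁ (refl , refl)))
      (subst (_∉ forbiddenAt w) (sym (ec₀-sym u w u~wᴴ))
             (oldColour-fresh uw (λ ()) (inj₂ (refl , refl))))

    open TriangleColours colours

    κ : Side → Fin (2 + r)
    κ vu = α
    κ vw = β
    κ uw = γ

    κ-injective : ∀ {σ σ′} → σ ≢ σ′ → κ σ ≢ κ σ′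
    κ-injective {vu} {vu} σ≢σ = ⊥-elim (σ≢σ refl)
    κ-injective {vw} {vw} σ≢σ = ⊥-elim (σ≢σ refl)
    κ-injective {uw} {uw} σ≢σ = ⊥-elim (σ≢σ refl)
    κ-injective {vu} {vw} _ = α≢β
    κ-injective {vu} {uw} _ = α≢γ
    κ-injective {vw} {uw} _ = β≢γ
    κ-injective {vw} {vu} _ = α≢β ∘ sym
    κ-injective {uw} {vu} _ = α≢γ ∘ sym
    κ-injective {uw} {vw} _ = β≢γ ∘ sym

    κ-fresh : ∀ {σ p q} → OnSide σ p q → FreshAt p (κ σ)
    κ-fresh {vu} (inj₁ (refl , _)) = freshAtV α≢e
    κ-fresh {vu} (inj₂ (refl , _)) = ∉⇒FreshAt (α∉Fu ∘ there)
    κ-fresh {vw} (inj₁ (refl , _)) = freshAtV β≢e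
    κ-fresh {vw} (inj₂ (refl , _)) = ∉⇒FreshAt (β∉Fw ∘ there)
    κ-fresh {uw} (inj₁ (refl , _)) = ∉⇒FreshAt (γ∉Fu ∘ there)
    κ-fresh {uw} (inj₂ (refl , _)) = ∉⇒FreshAt (γ∉Fw ∘ there)

    κ-vertex : ∀ {σ p q} → OnSide σ p q → p ≢ v → κ σ ≢ vc₀ p
    κ-vertex {vu} (inj₁ (refl , _)) v≢v = ⊥-elim (v≢v refl)
    κ-vertex {vu} (inj₂ (refl , _)) _   = α∉Fu ∘ here
    κ-vertex {vw} (inj₁ (refl , _)) v≢v = ⊥-elim (v≢v refl)
    κ-vertex {vw} (inj₂ (refl , _)) _   = β∉Fw ∘ here
    κ-vertex {uw} (inj₁ (refl , _)) _   = γ∉Fu ∘ here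
    κ-vertex {uw} (inj₂ (refl , _)) _   = γ∉Fw ∘ here

    δ-forbidden : List (Fin (2 + r))
    δ-forbidden = α ∷ β ∷ map (ec₀ v) (offSideNeighbours v) ++ map vc₀ (neighbours G v)

    δ-short : length δ-forbidden < 2 + r
    δ-short rewrite length-++ (map (ec₀ v) (offSideNeighbours v)) {map vc₀ (neighbours G v)}
                  | length-map (ec₀ v) (offSideNeighbours v) | length-map vc₀ (neighbours G v)
                  | length-neighbours G v | deg≡3
      = s≤s (s≤s (≤-trans (s≤s (+-monoˡ-≤ 3 offSide-v-≤1)) 5≤r))

    δ-choice : ∃ (_∉ δ-forbidden)
    δ-choice = ¬Covers⇒∃∉ (short⇒¬Covers δ-forbidden δ-short)

    δ : Fin (2 + r)
    δ = proj₁ δ-choice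

    δ∉ : δ ∉ δ-forbidden
    δ∉ = proj₂ δ-choice

    δ-side : ∀ {σ q} → OnSide σ v q → δ ≢ κ σ
    δ-side {vu} (inj₁ _)          = δ∉ ∘ here
    δ-side {vu} (inj₂ (v≡u , _)) = ⊥-elim (Adj⇒≢ G v~u v≡u)
    δ-side {vw} (inj₁ _)          = δ∉ ∘ there ∘ here
    δ-side {vw} (inj₂ (v≡w , _)) = ⊥-elim (Adj⇒≢ G v~w v≡w)
    δ-side {uw} (inj₁ (v≡u , _)) = ⊥-elim (Adj⇒≢ G v~u v≡u)
    δ-side {uw} (inj₂ (v≡w , _)) = ⊥-elim (Adj⇒≢ G v~w v≡w)

    δ-neighbour : ∀ {q} → Adj G v q → δ ≢ vc₀ q
    δ-neighbour v~q δ≡ =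
      δ∉ (there (there (∈-++⁺ʳ _ (Any.map (trans δ≡) (∈-map⁺ vc₀ (∈-neighbours G v~q))))))

    δ-fresh : FreshAt v δ
    δ-fresh = ∉⇒FreshAt (δ∉ ∘ there ∘ there ∘ ∈-++⁺ˡ)

    recolouring : Recolouring
    recolouring = record
      { κ = κ ; δ = δ ; κ-injective = κ-injective ; κ-fresh = κ-fresh ; κ-vertex = κ-vertex
      ; δ-side = δ-side ; δ-fresh = δ-fresh ; δ-neighbour = δ-neighbour }

  extend : ∀ {r} → MaxDegLE G r → 5 ≤ r → deg G v ≡ 3 →
    TotalColoring H (2 + r) → TotalColoring G (2 + r)
  extend Δ≤r 5≤r deg≡3 φ = Recolour.recolour φ (Extension.recolouring Δ≤r 5≤r deg≡3 φ)

lemma2p2 : (r : ℕ) → 13 ≤ r → (G : Graph) → Minimal r G →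
    (v : Fin (n G)) → deg G v ≡ 3 → ¬ InTriangle G v
lemma2p2 r 13≤r G ((connected , Δ≤r , uncolourable) , fewest) v deg≡3 (u , w , v~u , v~w , u~w) =
  <⇒≱ (deleteEdge-numEdges G v~u) (fewest H H-bad)
  where
    open Triangle G v~u v~w u~w
    H-bad : Bad r H
    H-bad = deleteEdge-connected G connected v⇝u
          , deleteEdge-maxDeg G Δ≤r
          , uncolourable ∘ extend Δ≤r (≤-trans (s≤s (s≤s (s≤s (s≤s (s≤s z≤n))))) 13≤r) deg≡3
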